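{- Let $q\ge 1$ be an integer, let $T[1,n]$ and $P[1,p]$ be finite sequences of numbers, and let $i\ge 0$ with $i+p\le n$ be such that $P[1,p]\approx T[i+1,i+p]$. Then $T_o[i+j]=P_o[j]$ for every $j$ such that $2\le j\le p$ and $j-T_o[i+j]\ge 1$.
   Context: Tie-breaking convention: for a sequence $S$ and positions $a,b$, write $a\prec_S b$ if $S[a]<S[b]$, or $S[a]=S[b]$ and $a<b$; i.e. among equal values an earlier occurrence is considered smaller, so all entries are treated as distinct. "Smallest", "largest", "min", "max" and "predecessor" below refer to this order. Two sequences $P,Q$ are order isomorphic, $P\approx Q$, if $|P|=|Q|$ and for all $1\le a,b\le |P|$: $a\preceq_P b \iff a\preceq_Q b$ (where $\preceq$ means $\prec$ or equal positions). For a sequence $S[1,m]$ and window size $q$, its order component $S_o[1,m]$ with entries in $\{0,\dots,q-1\}$ is defined as follows: for $1\le t\le m$ let $t_q=\max(1,t-q+1)$; set $S_o[t]=0$ if $S[t]$ is the smallest element of $S[t_q,t]$; otherwise set $S_o[t]=k$ where $S[t-k]$ is the immediate predecessor of $S[t]$ in $S[t_q,t]$, i.e. the largest element among $\{S[r]: t_q\le r<t,\ r\prec_S t\}$. Here $T_o$ and $P_o$ are the order components of $T$ and $P$ with the same $q$; $T[a,b]$ denotes the contiguous subsequence $T[a]T[a+1]\cdots T[b]$. -}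

module Defs where

open import Level using (Level)
open import Data.Nat as ℕ using (ℕ; zero; suc; _+_; _∸_; _⊔_)
import Data.Nat.Properties as ℕP
open import Data.List using (List; []; _∷_; map; upTo)
open import Data.Maybe using (Maybe; just; nothing)
open import Data.Product using (_×_; _,_)
open import Data.Sum using (_⊎_; inj₁; inj₂)
open import Relation.Binary.Bundles using (StrictTotalOrder)
open import Relation.Binary.Definitions using (tri<; tri≈; tri>)
open import Relation.Binary.PropositionalEquality using (_≡_)
open import Relation.Nullary using (Dec; yes; no; ¬_)
open import Function.Bundles using (_⇔_)

-- Sequences S[1,m] are represented as functions ℕ → Carrier; only the
-- entries at positions 1..m are ever inspected by the notions below.
module OrderComponent {c ℓ₁ ℓ₂ : Level} (O : StrictTotalOrder c ℓ₁ ℓ₂) where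
  open StrictTotalOrder O renaming (Carrier to A; _<_ to _<ₒ_; _≈_ to _≈ₒ_)

  Seq : Set c
  Seq = ℕ → A

  _≺⟨_⟩_ : ℕ → Seq → ℕ → Set _
  a ≺⟨ S ⟩ b = (S a <ₒ S b) ⊎ ((S a ≈ₒ S b) × (a ℕ.< b))

  _⪯⟨_⟩_ : ℕ → Seq → ℕ → Set _
  a ⪯⟨ S ⟩ b = (a ≺⟨ S ⟩ b) ⊎ (a ≡ b)

  OrdIso : ℕ → Seq → Seq → Set _
  OrdIso p P Q = ∀ a b → 1 ℕ.≤ a → a ℕ.≤ p → 1 ℕ.≤ b → b ℕ.≤ p →
                 (a ⪯⟨ P ⟩ b) ⇔ (a ⪯⟨ Q ⟩ b)

  shift : ℕ → Seq → Seq
  shift i S k = S (i + k)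

  ≺? : (S : Seq) (a b : ℕ) → Dec (a ≺⟨ S ⟩ b)
  ≺? S a b with compare (S a) (S b)
  ... | tri< x _ _ = yes (inj₁ x)
  ... | tri> ¬x ¬y _ = no λ { (inj₁ x) → ¬x x ; (inj₂ (y , _)) → ¬y y }
  ... | tri≈ ¬x y _ with a ℕ.<? b
  ...   | yes a<b = yes (inj₂ (y , a<b))
  ...   | no ¬a<b = no λ { (inj₁ x) → ¬x x ; (inj₂ (_ , z)) → ¬a<b z }

  bestPred : Seq → ℕ → Maybe ℕ → List ℕ → Maybe ℕ
  bestPred S t cur [] = cur
  bestPred S t cur (r ∷ rs) with ≺? S r t
  ... | no _ = bestPred S t cur rs
  ... | yes _ with cur
  ...   | nothing = bestPred S t (just r) rs
  ...   | just c with ≺? S c r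
  ...     | yes _ = bestPred S t (just r) rs
  ...     | no _ = bestPred S t (just c) rs

  tq : ℕ → ℕ → ℕ
  tq q t = 1 ⊔ (t + 1 ∸ q)

  oc : ℕ → Seq → ℕ → ℕ
  oc q S t with bestPred S t nothing (map (tq q t +_) (upTo (t ∸ tq q t)))
  ... | nothing = 0
  ... | just r = t ∸ r

-- A position r ≥ 1 lies in the window of j exactly when i + r lies in the window of i + j,
-- and on positions 1..p the isomorphism P ≈ T[i+1, i+p] matches ≺_P with ≺_T shifted by i.
-- Hence the predecessor of T[i+j] in its window, when it lies beyond position i (which is
-- what j - T_o[i+j] ≥ 1 says), is i plus the predecessor of P[j] in its window; and if T[i+j]
-- has no predecessor in its window, neither has P[j].
module Submission where

open import Defs
open import Level using (Level; _⊔_)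
open import Data.Nat using (ℕ; suc; _+_; _∸_; _≤_; _<_; z≤n; s≤s)
open import Data.Nat.Properties
open import Algebra.Properties.CommutativeSemigroup +-commutativeSemigroup using (x∙yz≈y∙xz)
open import Data.List using (List; []; _∷_; map; upTo)
open import Data.List.Membership.Propositional using (_∈_)
open import Data.List.Membership.Propositional.Properties
  using (∈-map⁺; ∈-map⁻; ∈-upTo⁺; ∈-upTo⁻)
open import Data.List.Relation.Unary.Any using (here; there)
open import Data.Maybe using (Maybe; just; nothing; maybe)
open import Data.Maybe.Relation.Unary.All using (All; just; nothing)
open import Data.Product using (_×_; _,_; proj₁; proj₂; ∃-syntax)
open import Data.Product.Relation.Binary.Lex.Strict using (×-strictTotalOrder)
open import Data.Sum using (inj₁; inj₂)
open import Function.Base using (_∘_)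
open import Function.Bundles using (_⇔_; mk⇔; Equivalence)
open import Function.Construct.Composition using (_⇔-∘_)
open import Relation.Binary.Bundles using (StrictTotalOrder)
open import Relation.Binary.Definitions using (tri<; tri≈; tri>)
open import Relation.Binary.PropositionalEquality using (_≡_; refl; trans; cong; subst; module ≡-Reasoning)
open import Relation.Nullary using (¬_; yes; no; contradiction)

open Equivalence using (to; from)

1≤n∸[m+n∸o]⇒m<o : ∀ {m n o} → 1 ≤ n ∸ (m + n ∸ o) → m < o
1≤n∸[m+n∸o]⇒m<o {m} {n} {o} 1≤n∸[m+n∸o] = ≰⇒> λ o≤m →
  contradiction (subst (1 ≤_) (m≤n⇒m∸n≡0 (n≤m+n∸o o≤m)) 1≤n∸[m+n∸o]) λ ()
  where
  n≤m+n∸o : o ≤ m → n ≤ m + n ∸ o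
  n≤m+n∸o o≤m = subst (_≤ m + n ∸ o) (m+n∸m≡n m n) (∸-monoʳ-≤ (m + n) o≤m)

m<n⇒∃[o]m+1+o≡n : ∀ {m n} → m < n → ∃[ o ] m + suc o ≡ n
m<n⇒∃[o]m+1+o≡n {m} m<n =
  let o , 1+m+o≡n = m≤n⇒∃[o]m+o≡n m<n in o , trans (+-suc m o) 1+m+o≡n

module OrderComponentProperties {c ℓ₁ ℓ₂ : Level} (O : StrictTotalOrder c ℓ₁ ℓ₂) where
  open OrderComponent O

  window : ℕ → ℕ → List ℕ
  window q t = map (tq q t +_) (upTo (t ∸ tq q t))

  -- t_q ≤ r < t, with t_q ≤ r unfolded
  InWindow : ℕ → ℕ → ℕ → Set
  InWindow q t r = 1 ≤ r × t < q + r × r < t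

  tq≤⇔ : ∀ {q t r} → tq q t ≤ r ⇔ (1 ≤ r × t < q + r)
  tq≤⇔ {q} {t} {r} = mk⇔
    (λ tq≤r → ≤-trans (m≤m⊔n 1 (t + 1 ∸ q)) tq≤r ,
              subst (_≤ q + r) (+-comm t 1)
                (≤-trans (m≤n+m∸n (t + 1) q) (+-monoʳ-≤ q (≤-trans (m≤n⊔m 1 (t + 1 ∸ q)) tq≤r))))
    (λ (1≤r , t<q+r) → ⊔-lub 1≤r (m≤n+o⇒m∸n≤o (t + 1) q (subst (_≤ q + r) (+-comm 1 t) t<q+r)))

  ∈-window⇔ : ∀ {q t r} → r ∈ window q t ⇔ InWindow q t r
  ∈-window⇔ {q} {t} {r} = mk⇔ inWindow ∈window
    where
    inWindow : r ∈ window q t → InWindow q t r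
    inWindow r∈ with x , x∈upTo , refl ← ∈-map⁻ (tq q t +_) r∈ =
      proj₁ 1≤r×t<q+r , proj₂ 1≤r×t<q+r ,
      subst (tq q t + x <_) (m+[n∸m]≡n tq≤t) (+-monoʳ-< (tq q t) x<t∸tq)
      where
      x<t∸tq : x < t ∸ tq q t
      x<t∸tq = ∈-upTo⁻ x∈upTo
      tq≤t : tq q t ≤ t
      tq≤t = <⇒≤ (m∸n≢0⇒n<m (m<n⇒n≢0 x<t∸tq))
      1≤r×t<q+r : 1 ≤ tq q t + x × t < q + (tq q t + x)
      1≤r×t<q+r = to (tq≤⇔ {q} {t}) (m≤m+n (tq q t) x)
    ∈window : InWindow q t r → r ∈ window q t
    ∈window (1≤r , t<q+r , r<t) =
      let tq≤r = from (tq≤⇔ {q} {t}) (1≤r , t<q+r)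
      in subst (_∈ window q t) (m+[n∸m]≡n tq≤r) (∈-map⁺ (tq q t +_) (∈-upTo⁺ (∸-monoˡ-< r<t tq≤r)))

  inWindow-+ : ∀ {q t r} i → InWindow q t r → InWindow q (i + t) (i + r)
  inWindow-+ {q} {t} {r} i (1≤r , t<q+r , r<t) =
    m≤n⇒m≤o+n i 1≤r ,
    subst (i + t <_) (x∙yz≈y∙xz i q r) (+-monoʳ-< i t<q+r) ,
    +-monoʳ-< i r<t

  inWindow-+⁻ : ∀ {q t r} i → 1 ≤ r → InWindow q (i + t) (i + r) → InWindow q t r
  inWindow-+⁻ {q} {t} {r} i 1≤r (_ , i+t<q+[i+r] , i+r<i+t) =
    1≤r ,
    +-cancelˡ-< i t (q + r) (subst (i + t <_) (x∙yz≈y∙xz q i r) i+t<q+[i+r]) ,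
    +-cancelˡ-< i r t i+r<i+t

  -- a ≺⟨ S ⟩ b is, definitionally, the lexicographic order on the pairs (S a , a).
  private
    module Lex = StrictTotalOrder (×-strictTotalOrder O <-strictTotalOrder)

  module _ {S : Seq} where

    ≺-irrefl : ∀ {a} → ¬ (a ≺⟨ S ⟩ a)
    ≺-irrefl = Lex.irrefl Lex.Eq.refl

    ≺⇒¬⪰ : ∀ {a b} → a ≺⟨ S ⟩ b → ¬ (b ⪯⟨ S ⟩ a)
    ≺⇒¬⪰ a≺b (inj₁ b≺a) = Lex.asym a≺b b≺a
    ≺⇒¬⪰ a≺b (inj₂ refl) = ≺-irrefl a≺b

    ¬≺⇒⪰ : ∀ {a b} → ¬ (a ≺⟨ S ⟩ b) → b ⪯⟨ S ⟩ a
    ¬≺⇒⪰ {a} {b} a⊀b with Lex.compare (S a , a) (S b , b)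
    ... | tri< a≺b _ _ = contradiction a≺b a⊀b
    ... | tri≈ _ (_ , refl) _ = inj₂ refl
    ... | tri> _ _ b≺a = inj₁ b≺a

    ¬⪰⇒≺ : ∀ {a b} → ¬ (b ⪯⟨ S ⟩ a) → a ≺⟨ S ⟩ b
    ¬⪰⇒≺ {a} {b} b⋠a with ≺? S a b
    ... | yes a≺b = a≺b
    ... | no a⊀b = contradiction (¬≺⇒⪰ a⊀b) b⋠a

    ⪯-trans : ∀ {a b d} → a ⪯⟨ S ⟩ b → b ⪯⟨ S ⟩ d → a ⪯⟨ S ⟩ d
    ⪯-trans (inj₁ a≺b) (inj₁ b≺d) = inj₁ (Lex.trans a≺b b≺d)
    ⪯-trans a⪯b (inj₂ refl) = a⪯b
    ⪯-trans (inj₂ refl) b⪯d = b⪯d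

    ⪯-antisym : ∀ {a b} → a ⪯⟨ S ⟩ b → b ⪯⟨ S ⟩ a → a ≡ b
    ⪯-antisym (inj₁ a≺b) b⪯a = contradiction b⪯a (≺⇒¬⪰ a≺b)
    ⪯-antisym (inj₂ a≡b) _ = a≡b

  data IsPredecessor (S : Seq) (t : ℕ) (W : ℕ → Set) : Maybe ℕ → Set (ℓ₁ ⊔ ℓ₂) where
    none : (∀ {r} → W r → ¬ r ≺⟨ S ⟩ t) → IsPredecessor S t W nothing
    some : ∀ {r} → W r → r ≺⟨ S ⟩ t → (∀ {r′} → W r′ → r′ ≺⟨ S ⟩ t → r′ ⪯⟨ S ⟩ r) →
           IsPredecessor S t W (just r)

  module _ {S : Seq} {t : ℕ} where

    isPredecessor-unique : ∀ {W m m′} →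
      IsPredecessor S t W m → IsPredecessor S t W m′ → m ≡ m′
    isPredecessor-unique (none _) (none _) = refl
    isPredecessor-unique (none no-r) (some w r≺t _) = contradiction r≺t (no-r w)
    isPredecessor-unique (some w r≺t _) (none no-r) = contradiction r≺t (no-r w)
    isPredecessor-unique (some w r≺t max) (some w′ r′≺t max′) =
      cong just (⪯-antisym (max′ w r≺t) (max w′ r′≺t))

    Dominated : (ℕ → Set) → ℕ → Set (ℓ₁ ⊔ ℓ₂)
    Dominated W r = ∃[ y ] W y × y ≺⟨ S ⟩ t × r ⪯⟨ S ⟩ y

    dominated-self : ∀ {W r} → W r → r ≺⟨ S ⟩ t → Dominated W r
    dominated-self w r≺t = _ , w , r≺t , inj₂ refl

    isPredecessor-extend : ∀ {W W′ m} → IsPredecessor S t W m →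
      (∀ {r} → W r → W′ r) → (∀ {r} → W′ r → r ≺⟨ S ⟩ t → Dominated W r) →
      IsPredecessor S t W′ m
    isPredecessor-extend (none no-r) _ dominated =
      none λ w′ r≺t → let _ , w , y≺t , _ = dominated w′ r≺t in no-r w y≺t
    isPredecessor-extend (some w r≺t max) W⊆W′ dominated =
      some (W⊆W′ w) r≺t λ w′ r′≺t →
        let _ , w , y≺t , r′⪯y = dominated w′ r′≺t in ⪯-trans r′⪯y (max w y≺t)

  bestPred-just : ∀ S t c L → c ≺⟨ S ⟩ t →
    IsPredecessor S t (_∈ c ∷ L) (bestPred S t (just c) L)
  bestPred-just S t c [] c≺t = some (here refl) c≺t λ { (here refl) _ → inj₂ refl }
  bestPred-just S t c (r ∷ rs) c≺t with ≺? S r t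
  ... | no r⊀t = isPredecessor-extend (bestPred-just S t c rs c≺t)
        (λ { (here refl) → here refl ; (there w) → there (there w) })
        λ { (here refl) c≺t → dominated-self (here refl) c≺t
          ; (there (here refl)) r≺t → contradiction r≺t r⊀t
          ; (there (there w)) r′≺t → dominated-self (there w) r′≺t }
  ... | yes r≺t with ≺? S c r
  ...   | yes c≺r = isPredecessor-extend (bestPred-just S t r rs r≺t) there
          λ { (here refl) _ → _ , here refl , r≺t , inj₁ c≺r
            ; (there w) r′≺t → dominated-self w r′≺t }
  ...   | no c⊀r = isPredecessor-extend (bestPred-just S t c rs c≺t)
          (λ { (here refl) → here refl ; (there w) → there (there w) })
          λ { (here refl) _ → dominated-self (here refl) c≺t
            ; (there (here refl)) _ → _ , here refl , c≺t , ¬≺⇒⪰ {S} c⊀r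
            ; (there (there w)) r′≺t → dominated-self (there w) r′≺t }

  bestPred-nothing : ∀ S t L → IsPredecessor S t (_∈ L) (bestPred S t nothing L)
  bestPred-nothing S t [] = none λ ()
  bestPred-nothing S t (r ∷ rs) with ≺? S r t
  ... | no r⊀t = isPredecessor-extend (bestPred-nothing S t rs) there
        λ { (here refl) r≺t → contradiction r≺t r⊀t ; (there w) r′≺t → dominated-self w r′≺t }
  ... | yes r≺t = bestPred-just S t r rs r≺t

  windowPredecessor : ∀ q S t → ∃[ m ] IsPredecessor S t (InWindow q t) m
  windowPredecessor q S t = _ , isPredecessor-extend (bestPred-nothing S t (window q t))
    (to ∈-window⇔) λ w r≺t → dominated-self (from ∈-window⇔ w) r≺t

  lag : ℕ → Maybe ℕ → ℕ
  lag t = maybe (t ∸_) 0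

  oc≡lag : ∀ q S t → oc q S t ≡ lag t (bestPred S t nothing (window q t))
  oc≡lag q S t with bestPred S t nothing (window q t)
  ... | nothing = refl
  ... | just r = refl

  oc-isPredecessor : ∀ {q S t m} → IsPredecessor S t (InWindow q t) m → oc q S t ≡ lag t m
  oc-isPredecessor {q} {S} {t} pred = trans (oc≡lag q S t)
    (cong (lag t) (isPredecessor-unique (proj₂ (windowPredecessor q S t)) pred))

  module _ {S S′ : Seq} {f : ℕ → ℕ} {D : ℕ → Set}
           (⪯-embed : ∀ {a b} → D a → D b → a ⪯⟨ S′ ⟩ b ⇔ f a ⪯⟨ S ⟩ f b) where

    ≺-embed : ∀ {a b} → D a → D b → a ≺⟨ S′ ⟩ b ⇔ f a ≺⟨ S ⟩ f b
    ≺-embed da db = mk⇔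
      (λ a≺b → ¬⪰⇒≺ {S} (≺⇒¬⪰ {S′} a≺b ∘ from (⪯-embed db da)))
      (λ fa≺fb → ¬⪰⇒≺ {S′} (≺⇒¬⪰ {S} fa≺fb ∘ to (⪯-embed db da)))

    isPredecessor-pullback : ∀ {t W W′ m} → D t → (∀ {r} → W′ r → D r × W (f r)) →
      IsPredecessor S (f t) W (Data.Maybe.map f m) → All W′ m → IsPredecessor S′ t W′ m
    isPredecessor-pullback {m = nothing} dt W′⇒W (none no-r) nothing =
      none λ w′ r≺t → let dr , w = W′⇒W w′ in no-r w (to (≺-embed dr dt) r≺t)
    isPredecessor-pullback {m = just s} dt W′⇒W (some _ fs≺ft max) (just w′s) =
      let ds , _ = W′⇒W w′s in
      some w′s (from (≺-embed ds dt) fs≺ft) λ w′ r≺t →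
        let dr , w = W′⇒W w′ in from (⪯-embed dr ds) (max w (to (≺-embed dr dt) r≺t))

  ⪯-shift : ∀ i T {a b} → a ⪯⟨ shift i T ⟩ b ⇔ (i + a) ⪯⟨ T ⟩ (i + b)
  ⪯-shift i T {a} {b} = mk⇔
    (λ { (inj₁ (inj₁ x)) → inj₁ (inj₁ x)
       ; (inj₁ (inj₂ (e , a<b))) → inj₁ (inj₂ (e , +-monoʳ-< i a<b))
       ; (inj₂ refl) → inj₂ refl })
    (λ { (inj₁ (inj₁ x)) → inj₁ (inj₁ x)
       ; (inj₁ (inj₂ (e , i+a<i+b))) → inj₁ (inj₂ (e , +-cancelˡ-< i a b i+a<i+b))
       ; (inj₂ i+a≡i+b) → inj₂ (+-cancelˡ-≡ i a b i+a≡i+b) })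

  module _ {q p i : ℕ} {T P : Seq} (iso : OrdIso p P (shift i T))
           {j : ℕ} (1≤j : 1 ≤ j) (j≤p : j ≤ p) where

    private
      InRange : ℕ → Set
      InRange a = 1 ≤ a × a ≤ p

      ⪯-match : ∀ {a b} → InRange a → InRange b → a ⪯⟨ P ⟩ b ⇔ (i + a) ⪯⟨ T ⟩ (i + b)
      ⪯-match (1≤a , a≤p) (1≤b , b≤p) = ⪯-shift i T ⇔-∘ iso _ _ 1≤a a≤p 1≤b b≤p

      window⇒shifted : ∀ {r} → InWindow q j r → InRange r × InWindow q (i + j) (i + r)
      window⇒shifted w@(1≤r , _ , r<j) = (1≤r , ≤-trans (<⇒≤ r<j) j≤p) , inWindow-+ i w

    isPredecessor-match : ∀ {m} →
      IsPredecessor T (i + j) (InWindow q (i + j)) (Data.Maybe.map (i +_) m) →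
      All (InWindow q j) m → IsPredecessor P j (InWindow q j) m
    isPredecessor-match = isPredecessor-pullback ⪯-match (1≤j , j≤p) window⇒shifted

lemma1 : ∀ {c ℓ₁ ℓ₂ : Level} (O : StrictTotalOrder c ℓ₁ ℓ₂) →
    let open OrderComponent O in
    (q n p i : ℕ) (T P : Seq) →
    1 ≤ q → i + p ≤ n →
    OrdIso p P (shift i T) →
    (j : ℕ) → 2 ≤ j → j ≤ p → 1 ≤ j ∸ oc q T (i + j) →
    oc q T (i + j) ≡ oc q P j
lemma1 O q n p i T P _ _ iso j 2≤j j≤p 1≤j∸oc = agree (windowPredecessor q T (i + j))
  where
  open OrderComponent O
  open OrderComponentProperties O
  open ≡-Reasoning

  1≤j : 1 ≤ j
  1≤j = ≤-trans (n≤1+n 1) 2≤j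

  beyond-i : ∀ {r} → IsPredecessor T (i + j) (InWindow q (i + j)) (just r) → i < r
  beyond-i {r} predT =
    1≤n∸[m+n∸o]⇒m<o {i} {j} {r} (subst (λ k → 1 ≤ j ∸ k) (oc-isPredecessor predT) 1≤j∸oc)

  agree : ∃[ m ] IsPredecessor T (i + j) (InWindow q (i + j)) m → oc q T (i + j) ≡ oc q P j
  agree (nothing , predT) = begin
    oc q T (i + j)  ≡⟨ oc-isPredecessor predT ⟩
    0               ≡⟨ oc-isPredecessor (isPredecessor-match iso 1≤j j≤p predT nothing) ⟨
    oc q P j        ∎
  agree (just r , predT@(some w _ _))
    with m<n⇒∃[o]m+1+o≡n (beyond-i predT)
  ... | o , refl = begin
    oc q T (i + j)       ≡⟨ oc-isPredecessor predT ⟩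
    i + j ∸ (i + suc o)  ≡⟨ [m+n]∸[m+o]≡n∸o i j (suc o) ⟩
    j ∸ suc o            ≡⟨ oc-isPredecessor predP ⟨
    oc q P j             ∎
    where
    predP : IsPredecessor P j (InWindow q j) (just (suc o))
    predP = isPredecessor-match iso 1≤j j≤p predT (just (inWindow-+⁻ i (s≤s z≤n) w))
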